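{- Let $(\mathbf{C},\mathcal{M})$ be an $\mathcal{M}$-adhesive category ($\mathcal{M}$ a class of monomorphisms) with a strict $\mathcal{M}$-initial object $\varnothing$. Let $X,Y,Z$ be objects and $f:Z\to X+Y$ an $\mathcal{M}$-morphism. Let $V$ be the pullback of $X\xrightarrow{in_X}X+Y\xleftarrow{f}Z$ with projection $v:V\to X$, and $W$ the pullback of $Z\xrightarrow{f}X+Y\xleftarrow{in_Y}Y$ with projection $w:W\to Y$. Then $Z\cong V+W$, and under this isomorphism $f=[in_X\circ v,\,in_Y\circ w]$ (i.e. $f$ is $v+w$), with $v,w\in\mathcal{M}$.
   Context: $(\mathbf{C},\mathcal{M})$ is $\mathcal{M}$-adhesive: $\mathcal{M}$ contains isos, is closed under composition and decomposition; pushouts of spans and pullbacks of cospans with a leg in $\mathcal{M}$ exist; $\mathcal{M}$ is stable under pushout and pullback; pushouts along $\mathcal{M}$-morphisms are $\mathcal{M}$-van Kampen squares (in a commutative cube whose bottom face is a pushout along an $\mathcal{M}$-morphism, whose back faces are pullbacks and whose remaining vertical morphisms are in $\mathcal{M}$, the top face is a pushout iff the front faces are pullbacks). A strict $\mathcal{M}$-initial object $\varnothing$: for every object $A$ there is a unique monomorphism $\varnothing\to A$, lying in $\mathcal{M}$, and every morphism $U\to\varnothing$ is an isomorphism. Binary coproducts $X+Y$ exist (pushout of $X\leftarrow\varnothing\to Y$) with injections $in_X,in_Y$ in $\mathcal{M}$; $[\cdot,\cdot]$ denotes copairing. -}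

module Defs where

open import Level using (Level; _⊔_) renaming (suc to lsuc)
open import Data.Product using (Σ; _×_; _,_)
open import Relation.Binary using (Rel; IsEquivalence)

record Category (o ℓ e : Level) : Set (lsuc (o ⊔ ℓ ⊔ e)) where
  infixr 9 _∘_
  infix 4 _≈_
  field
    Obj   : Set o
    _⇒_   : Obj → Obj → Set ℓ
    _≈_   : ∀ {A B} → Rel (A ⇒ B) e
    id    : ∀ {A} → A ⇒ A
    _∘_   : ∀ {A B C} → B ⇒ C → A ⇒ B → A ⇒ C
    equiv : ∀ {A B} → IsEquivalence (_≈_ {A} {B})
    ∘-resp-≈ : ∀ {A B C} {f h : B ⇒ C} {g i : A ⇒ B} → f ≈ h → g ≈ i → f ∘ g ≈ h ∘ i
    assoc : ∀ {A B C D} {f : A ⇒ B} {g : B ⇒ C} {h : C ⇒ D} → (h ∘ g) ∘ f ≈ h ∘ (g ∘ f)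
    identityˡ : ∀ {A B} {f : A ⇒ B} → id ∘ f ≈ f
    identityʳ : ∀ {A B} {f : A ⇒ B} → f ∘ id ≈ f

module Definitions {o ℓ e : Level} (C : Category o ℓ e) where
  open Category C

  Mono : ∀ {A B} → A ⇒ B → Set (o ⊔ ℓ ⊔ e)
  Mono {A} f = ∀ {Q} (g h : Q ⇒ A) → f ∘ g ≈ f ∘ h → g ≈ h

  IsIso : ∀ {A B} → A ⇒ B → Set (ℓ ⊔ e)
  IsIso {A} {B} f = Σ (B ⇒ A) (λ g → (g ∘ f ≈ id) × (f ∘ g ≈ id))

  record IsPullback {P A B D : Obj} (p₁ : P ⇒ A) (p₂ : P ⇒ B) (f : A ⇒ D) (g : B ⇒ D)
         : Set (o ⊔ ℓ ⊔ e) where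
    field
      commute   : f ∘ p₁ ≈ g ∘ p₂
      universal : ∀ {Q} (q₁ : Q ⇒ A) (q₂ : Q ⇒ B) → f ∘ q₁ ≈ g ∘ q₂ →
                  Σ (Q ⇒ P) (λ u → (p₁ ∘ u ≈ q₁) × (p₂ ∘ u ≈ q₂) ×
                    (∀ (u′ : Q ⇒ P) → p₁ ∘ u′ ≈ q₁ → p₂ ∘ u′ ≈ q₂ → u′ ≈ u))

  record IsPushout {A B C D : Obj} (f : A ⇒ B) (g : A ⇒ C) (i₁ : B ⇒ D) (i₂ : C ⇒ D)
         : Set (o ⊔ ℓ ⊔ e) where
    field
      commute   : i₁ ∘ f ≈ i₂ ∘ g
      universal : ∀ {Q} (q₁ : B ⇒ Q) (q₂ : C ⇒ Q) → q₁ ∘ f ≈ q₂ ∘ g →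
                  Σ (D ⇒ Q) (λ u → (u ∘ i₁ ≈ q₁) × (u ∘ i₂ ≈ q₂) ×
                    (∀ (u′ : D ⇒ Q) → u′ ∘ i₁ ≈ q₁ → u′ ∘ i₂ ≈ q₂ → u′ ≈ u))

  record IsCoproduct {A B S : Obj} (i₁ : A ⇒ S) (i₂ : B ⇒ S) : Set (o ⊔ ℓ ⊔ e) where
    field
      [_,_]   : ∀ {T} → A ⇒ T → B ⇒ T → S ⇒ T
      inject₁ : ∀ {T} {a : A ⇒ T} {b : B ⇒ T} → [ a , b ] ∘ i₁ ≈ a
      inject₂ : ∀ {T} {a : A ⇒ T} {b : B ⇒ T} → [ a , b ] ∘ i₂ ≈ b
      unique  : ∀ {T} {a : A ⇒ T} {b : B ⇒ T} (h : S ⇒ T) →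
                h ∘ i₁ ≈ a → h ∘ i₂ ≈ b → h ≈ [ a , b ]

  record IsMAdhesive {m : Level} (M : ∀ {A B} → A ⇒ B → Set m)
         : Set (o ⊔ ℓ ⊔ e ⊔ m) where
    field
      M-resp-≈ : ∀ {A B} {f g : A ⇒ B} → f ≈ g → M f → M g
      M-mono   : ∀ {A B} {f : A ⇒ B} → M f → Mono f
      M-iso    : ∀ {A B} {f : A ⇒ B} → IsIso f → M f
      M-comp   : ∀ {A B D} {f : A ⇒ B} {g : B ⇒ D} → M f → M g → M (g ∘ f)
      M-decomp : ∀ {A B D} {f : A ⇒ B} {g : B ⇒ D} → M (g ∘ f) → M g → M f
      pushout-exists : ∀ {A B C} (m₀ : A ⇒ B) (f : A ⇒ C) → M m₀ →
                       Σ Obj (λ D → Σ (B ⇒ D) (λ n → Σ (C ⇒ D) (λ g → IsPushout m₀ f n g)))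
      pullback-exists : ∀ {B C D} (n : B ⇒ D) (g : C ⇒ D) → M g →
                        Σ Obj (λ P → Σ (P ⇒ B) (λ p₁ → Σ (P ⇒ C) (λ p₂ → IsPullback p₁ p₂ n g)))
      pushout-stable : ∀ {A B C D} {m₀ : A ⇒ B} {f : A ⇒ C} {n : B ⇒ D} {g : C ⇒ D} →
                       M m₀ → IsPushout m₀ f n g → M g
      pullback-stable : ∀ {P B C D} {p₁ : P ⇒ B} {p₂ : P ⇒ C} {n : B ⇒ D} {g : C ⇒ D} →
                        M g → IsPullback p₁ p₂ n g → M p₁
      -- pushouts along M-morphisms are M-van Kampen squares
      -- bottom face: pushout  B <-m₀- A -f-> C,  n : B → D, g : C → D
      -- top face: A′ B′ C′ D′ with m′ f′ n′ g′; vertical a b c d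
      vanKampen :
        ∀ {A B C D A′ B′ C′ D′}
          {m₀ : A ⇒ B} {f : A ⇒ C} {n : B ⇒ D} {g : C ⇒ D}
          {m′ : A′ ⇒ B′} {f′ : A′ ⇒ C′} {n′ : B′ ⇒ D′} {g′ : C′ ⇒ D′}
          {a : A′ ⇒ A} {b : B′ ⇒ B} {c : C′ ⇒ C} {d : D′ ⇒ D} →
        M m₀ → IsPushout m₀ f n g →
        n′ ∘ m′ ≈ g′ ∘ f′ →
        n ∘ b ≈ d ∘ n′ → g ∘ c ≈ d ∘ g′ →
        IsPullback m′ a b m₀ → IsPullback f′ a c f →
        M b → M c → M d →
        (IsPushout m′ f′ n′ g′ → IsPullback n′ b d n × IsPullback g′ c d g) ×
        (IsPullback n′ b d n × IsPullback g′ c d g → IsPushout m′ f′ n′ g′)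

  record IsStrictMInitial {m : Level} (M : ∀ {A B} → A ⇒ B → Set m) (∅ : Obj)
         : Set (o ⊔ ℓ ⊔ e ⊔ m) where
    field
      ¡        : ∀ A → ∅ ⇒ A
      ¡-unique : ∀ {A} (h : ∅ ⇒ A) → h ≈ ¡ A
      ¡-mono   : ∀ {A} → Mono (¡ A)
      ¡-M      : ∀ {A} → M (¡ A)
      strict   : ∀ {U} (h : U ⇒ ∅) → IsIso h

-- The coproduct X + Y is the pushout of X ← ∅ → Y, which lies along an M-morphism.
-- Pulling it back along f gives a cube whose top face is V ← ∅ → W: the back faces
-- are pullbacks because every cone over ∅ has initial apex (strictness), and the
-- front faces are the given pullbacks V and W. By the van Kampen property the top
-- face is a pushout, i.e. Z is a coproduct of V and W with injections v′ and w′.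
module Submission where

open import Defs
open import Level using (Level)
open import Data.Product using (Σ; _×_; _,_; proj₁; proj₂)
open import Relation.Binary using (IsEquivalence)

module CategoryLemmas {o ℓ e : Level} (C : Category o ℓ e) where
  open Category C
  open Definitions C
  module ≈ {A B} = IsEquivalence (equiv {A} {B})

  pullʳ : ∀ {A B D E} {h : D ⇒ E} {k : B ⇒ D} {x : A ⇒ B} {y : A ⇒ D} →
          k ∘ x ≈ y → (h ∘ k) ∘ x ≈ h ∘ y
  pullʳ p = ≈.trans assoc (∘-resp-≈ ≈.refl p)

  IsPullback-swap : ∀ {P A B D} {p₁ : P ⇒ A} {p₂ : P ⇒ B} {f : A ⇒ D} {g : B ⇒ D} →
                    IsPullback p₁ p₂ f g → IsPullback p₂ p₁ g f
  IsPullback-swap pb = record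
    { commute   = ≈.sym commute
    ; universal = λ q₁ q₂ c →
        let (u , u₁ , u₂ , uniq) = universal q₂ q₁ (≈.sym c)
        in u , u₂ , u₁ , λ u′ p₂ p₁ → uniq u′ p₁ p₂
    }
    where open IsPullback pb

  copair-∘ : ∀ {A B S T U} {i₁ : A ⇒ S} {i₂ : B ⇒ S} (cp : IsCoproduct i₁ i₂)
             {h : T ⇒ U} {a : A ⇒ T} {b : B ⇒ T} {a′ : A ⇒ U} {b′ : B ⇒ U} →
             h ∘ a ≈ a′ → h ∘ b ≈ b′ →
             h ∘ IsCoproduct.[_,_] cp a b ≈ IsCoproduct.[_,_] cp a′ b′
  copair-∘ cp ha hb = unique _ (≈.trans (pullʳ inject₁) ha) (≈.trans (pullʳ inject₂) hb)
    where open IsCoproduct cp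

  copair-injections-iso : ∀ {A B S T} {i₁ : A ⇒ S} {i₂ : B ⇒ S} {j₁ : A ⇒ T} {j₂ : B ⇒ T}
                          (cpS : IsCoproduct i₁ i₂) (cpT : IsCoproduct j₁ j₂) →
                          IsIso (IsCoproduct.[_,_] cpS j₁ j₂)
  copair-injections-iso {i₁ = i₁} {i₂} {j₁} {j₂} cpS cpT =
      T.[ i₁ , i₂ ]
    , ≈.trans (copair-∘ cpS T.inject₁ T.inject₂) (≈.sym (S.unique id identityˡ identityˡ))
    , ≈.trans (copair-∘ cpT S.inject₁ S.inject₂) (≈.sym (T.unique id identityˡ identityˡ))
    where
      module S = IsCoproduct cpS
      module T = IsCoproduct cpT

module StrictInitialLemmas {o ℓ e m : Level} (C : Category o ℓ e)
  (M : ∀ {A B} → Category._⇒_ C A B → Set m) (∅ : Category.Obj C)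
  (initial : Definitions.IsStrictMInitial C M ∅) where
  open Category C
  open Definitions C
  open CategoryLemmas C
  open IsStrictMInitial initial

  ¡-irrelevant : ∀ {A} (h k : ∅ ⇒ A) → h ≈ k
  ¡-irrelevant h k = ≈.trans (¡-unique h) (≈.sym (¡-unique k))

  -- A cone over ¡ X has a leg into ∅, so by strictness its apex is itself initial.
  ¡-pullback : ∀ {B X} (b : B ⇒ X) → IsPullback (¡ B) id b (¡ X)
  ¡-pullback {B} b = record
    { commute   = ¡-irrelevant _ _
    ; universal = λ q₁ q₂ _ →
        let (q₂⁻¹ , q₂⁻¹∘q₂≈id , _) = strict q₂
        in q₂
         , ≈.trans (∘-resp-≈ (¡-irrelevant (¡ B) (q₁ ∘ q₂⁻¹)) ≈.refl)
                   (≈.trans (pullʳ q₂⁻¹∘q₂≈id) identityʳ)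
         , identityˡ
         , λ u′ _ id∘u′≈q₂ → ≈.trans (≈.sym identityˡ) id∘u′≈q₂
    }

  coproduct⇒pushout : ∀ {A B S} {i₁ : A ⇒ S} {i₂ : B ⇒ S} →
                      IsCoproduct i₁ i₂ → IsPushout (¡ A) (¡ B) i₁ i₂
  coproduct⇒pushout cp = record
    { commute   = ¡-irrelevant _ _
    ; universal = λ q₁ q₂ _ → [ q₁ , q₂ ] , inject₁ , inject₂ , unique
    }
    where open IsCoproduct cp

  pushout⇒coproduct : ∀ {A B S} {i₁ : A ⇒ S} {i₂ : B ⇒ S} →
                      IsPushout (¡ A) (¡ B) i₁ i₂ → IsCoproduct i₁ i₂
  pushout⇒coproduct {A} {B} {S} {i₁} {i₂} po = record
    { [_,_]   = λ a b → proj₁ (copair a b)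
    ; inject₁ = λ {_} {a} {b} → proj₁ (proj₂ (copair a b))
    ; inject₂ = λ {_} {a} {b} → proj₁ (proj₂ (proj₂ (copair a b)))
    ; unique  = λ {_} {a} {b} → proj₂ (proj₂ (proj₂ (copair a b)))
    }
    where
      copair : ∀ {T} (a : A ⇒ T) (b : B ⇒ T) →
               Σ (S ⇒ T) (λ u → (u ∘ i₁ ≈ a) × (u ∘ i₂ ≈ b) ×
                 (∀ (u′ : S ⇒ T) → u′ ∘ i₁ ≈ a → u′ ∘ i₂ ≈ b → u′ ≈ u))
      copair a b = IsPushout.universal po a b (¡-irrelevant _ _)

module AdhesiveLemmas {o ℓ e m : Level} (C : Category o ℓ e)
  (M : ∀ {A B} → Category._⇒_ C A B → Set m) (adhesive : Definitions.IsMAdhesive C M)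
  (∅ : Category.Obj C) (initial : Definitions.IsStrictMInitial C M ∅) where
  open Category C
  open Definitions C
  open CategoryLemmas C
  open StrictInitialLemmas C M ∅ initial
  open IsMAdhesive adhesive
  open IsStrictMInitial initial

  pullback-of-coproduct-is-coproduct :
    ∀ {X Y XY Z} {inX : X ⇒ XY} {inY : Y ⇒ XY} → IsCoproduct inX inY →
    (f : Z ⇒ XY) → M f →
    ∀ {V} (v : V ⇒ X) (v′ : V ⇒ Z) → IsPullback v v′ inX f →
    ∀ {W} (w′ : W ⇒ Z) (w : W ⇒ Y) → IsPullback w′ w f inY →
    IsCoproduct v′ w′
  pullback-of-coproduct-is-coproduct cpXY f Mf v v′ pbV w′ w pbW =
    pushout⇒coproduct (proj₂ (vanKampen {m′ = ¡ _} {f′ = ¡ _} {a = id}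
      ¡-M (coproduct⇒pushout cpXY) (¡-irrelevant _ _)
      (IsPullback.commute pbV) (≈.sym (IsPullback.commute pbW))
      (¡-pullback v) (¡-pullback w)
      (pullback-stable Mf pbV) (pullback-stable Mf (IsPullback-swap pbW)) Mf)
      (IsPullback-swap pbV , pbW))

lemmaA5 : ∀ {o ℓ e m : Level} (C : Category o ℓ e) →
    let open Category C
        open Definitions C
    in (M : ∀ {A B} → A ⇒ B → Set m) → IsMAdhesive M →
       (∅ : Obj) → IsStrictMInitial M ∅ →
       ∀ {X Y XY Z : Obj} {inX : X ⇒ XY} {inY : Y ⇒ XY} → IsCoproduct inX inY →
       (f : Z ⇒ XY) → M f →
       ∀ {V : Obj} (v : V ⇒ X) (v′ : V ⇒ Z) → IsPullback v v′ inX f →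
       ∀ {W : Obj} (w′ : W ⇒ Z) (w : W ⇒ Y) → IsPullback w′ w f inY →
       ∀ {VW : Obj} {jV : V ⇒ VW} {jW : W ⇒ VW} (cpVW : IsCoproduct jV jW) →
       Σ (VW ⇒ Z) (λ φ → IsIso φ × (f ∘ φ ≈ IsCoproduct.[_,_] cpVW (inX ∘ v) (inY ∘ w)))
         × M v × M w
lemmaA5 C M adhesive ∅ initial cpXY f Mf v v′ pbV w′ w pbW cpVW =
    ( [ v′ , w′ ]
    , copair-injections-iso cpVW
        (pullback-of-coproduct-is-coproduct cpXY f Mf v v′ pbV w′ w pbW)
    , copair-∘ cpVW (≈.sym (IsPullback.commute pbV)) (IsPullback.commute pbW) )
  , pullback-stable Mf pbV
  , pullback-stable Mf (IsPullback-swap pbW)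
  where
    open CategoryLemmas C
    open AdhesiveLemmas C M adhesive ∅ initial
    open Definitions C
    open IsMAdhesive adhesive using (pullback-stable)
    open IsCoproduct cpVW using ([_,_])
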